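{- Let $B$ be any set of permutations and let $\mathcal{C}=\operatorname{Av}(B)$. Then the set of permutations that can be generated by the $\mathcal{C}$-machine is exactly the permutation class \[ \operatorname{Av}(1\ominus B)=\operatorname{Av}(\{1\ominus\beta\::\:\beta\in B\}). \]
   Context: A permutation $\pi$ contains $\sigma$ if $\pi$ has a subsequence order isomorphic to $\sigma$; otherwise $\pi$ avoids $\sigma$. For a set $B$ of permutations, $\operatorname{Av}(B)$ is the set of permutations avoiding every element of $B$. A permutation class is a set of permutations closed downward under containment. For a permutation $\beta$ of length $\ell$, the skew sum $1\ominus\beta$ is the permutation of length $\ell+1$ given by $(1\ominus\beta)(1)=\ell+1$ and $(1\ominus\beta)(i)=\beta(i-1)$ for $2\le i\le \ell+1$. For a permutation class $\mathcal{C}$, the $\mathcal{C}$-machine is defined as follows. It has an input, initially $1,2,\dots,n$, a container, initially empty, holding a sequence of distinct integers, and an output, initially empty. At any time one may perform one of three operations: (bypass) remove the next entry of the input and append it to the end of the output; (push) remove the next entry of the input and insert it at any position of the container, provided the resulting sequence in the container is order isomorphic to a permutation in $\mathcal{C}$; (pop) remove the leftmost entry of the container and append it to the end of the output. A permutation $\pi$ of length $n$ can be generated by the $\mathcal{C}$-machine if some sequence of these operations, starting from input $1,2,\dots,n$, ends with empty input and empty container and with output equal to $\pi$ (read left to right). -}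

module Defs where

open import Data.Nat using (ℕ; suc; _<_)
open import Data.List using (List; []; _∷_; _++_; [_]; length; map; upTo; lookup)
open import Data.List.Relation.Binary.Permutation.Propositional using (_↭_)
open import Data.List.Relation.Binary.Sublist.Propositional using (_⊆_)
open import Data.Fin using (Fin; cast)
open import Data.Product using (Σ; ∃; _×_; _,_)
open import Function.Bundles using (_⇔_)
open import Relation.Nullary using (¬_)
open import Relation.Binary.PropositionalEquality using (_≡_)
open import Relation.Binary.Construct.Closure.ReflexiveTransitive using (Star)

range1 : ℕ → List ℕ
range1 n = map suc (upTo n)

IsPerm : List ℕ → Set
IsPerm π = π ↭ range1 (length π)

OrdIso : List ℕ → List ℕ → Set
OrdIso xs ys = Σ (length xs ≡ length ys) λ e →
  ∀ (i j : Fin (length xs)) →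
    (lookup xs i < lookup xs j) ⇔ (lookup ys (cast e i) < lookup ys (cast e j))

Contains : List ℕ → List ℕ → Set
Contains π σ = ∃ λ s → (s ⊆ π) × OrdIso s σ

Av : (List ℕ → Set) → List ℕ → Set
Av B π = IsPerm π × (∀ β → B β → ¬ Contains π β)

skew1 : List ℕ → List ℕ
skew1 β = suc (length β) ∷ β

SkewSet : (List ℕ → Set) → List ℕ → Set
SkewSet B σ = ∃ λ β → B β × (σ ≡ skew1 β)

-- machine state: (input , container , output)
State : Set
State = List ℕ × List ℕ × List ℕ

InClass : (List ℕ → Set) → List ℕ → Set
InClass C c = ∃ λ τ → C τ × OrdIso c τ

data Step (C : List ℕ → Set) : State → State → Set where
  bypass : ∀ {x inp c out} →
    Step C (x ∷ inp , c , out) (inp , c , out ++ [ x ])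
  push : ∀ {x inp out} (l r : List ℕ) → InClass C (l ++ x ∷ r) →
    Step C (x ∷ inp , l ++ r , out) (inp , l ++ x ∷ r , out)
  pop : ∀ {x inp c out} →
    Step C (inp , x ∷ c , out) (inp , c , out ++ [ x ])

Generated : (List ℕ → Set) → List ℕ → Set
Generated C π = Star (Step C) (range1 (length π) , [] , []) ([] , [] , π)

-- If π is generated, then at every moment all entries of w = output ++ container are smaller than the
-- remaining input, and the container avoids B.  Pushing or bypassing the next input x inserts it into w as
-- a new maximum followed only by container entries, so an occurrence of 1 ⊖ β through x would start at x
-- and leave an occurrence of β inside the container.  Hence w, and finally π, avoids 1 ⊖ B.
-- Conversely, if π avoids 1 ⊖ B, output it greedily: pop the next entry y if it is in the container, else
-- push the smaller input entries in π-order and bypass y.  Each container consists of entries that follow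
-- some y in π and lie below it, so it avoids B, and its standardisation is a witness in Av B.

module Submission where

open import Defs
open import Data.Nat using (ℕ; zero; suc; _+_; _∸_; _<_; _≤_; _≤?_; _<?_; z≤n; s≤s; _<‴_; ≤‴-refl; ≤‴-step)
open import Data.Nat.Properties
open import Data.List using (List; []; _∷_; _++_; [_]; length; map; upTo; applyUpTo; lookup; filter)
open import Data.List.Properties
  using (++-assoc; ++-identityʳ; length-map; map-upTo; length-upTo; filter-accept; filter-reject; filter-++; filter-none)
open import Data.List.Membership.Propositional using (_∈_; _∉_)
open import Data.List.Membership.Propositional.Properties using (∈-map⁺; ∈-map⁻; ∈-upTo⁺; ∈-upTo⁻; ∈-∃++; ∈-++⁺ˡ; ∈-++⁺ʳ)
open import Data.List.Relation.Unary.All as All using (All; []; _∷_)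
import Data.List.Relation.Unary.All.Properties as All
open import Data.List.Relation.Unary.Any using (here; there)
open import Data.List.Relation.Unary.AllPairs as AllPairs using (AllPairs; []; _∷_)
import Data.List.Relation.Unary.AllPairs.Properties as AllPairs
open import Data.List.Relation.Unary.Unique.Propositional using (Unique)
import Data.List.Relation.Unary.Unique.Propositional.Properties as Unique
open import Data.List.Relation.Binary.Pointwise as Pointwise using (Pointwise; []; _∷_)
open import Data.List.Relation.Binary.Sublist.Propositional using (_⊆_; []; _∷_; _∷ʳ_; ⊆-refl; ⊆-trans)
open import Data.List.Relation.Binary.Sublist.Propositional.Properties using (All-resp-⊆; ++⁺ˡ; filter-⊆)
open import Data.List.Relation.Binary.Permutation.Propositional
  using (_↭_; ↭-refl; ↭-sym; ↭-trans; ↭-reflexive; prep; ↭⇒↭ₛ; module PermutationReasoning)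
open import Data.List.Relation.Binary.Permutation.Propositional.Properties using (shift; ∈-resp-↭; All-resp-↭; ↭-length)
import Data.List.Relation.Binary.Permutation.Propositional.Properties as Perm
open import Data.Fin using (cast; toℕ) renaming (zero to fzero; suc to fsuc)
open import Data.Fin.Properties using (toℕ-injective; toℕ-cast)
open import Data.Product using (∃; _×_; _,_; proj₁; proj₂)
open import Data.Sum using (_⊎_; inj₁; inj₂)
open import Data.Empty using (⊥-elim)
open import Data.Unit using (⊤; tt)
open import Function.Base using (id; _∘_; case_of_)
open import Function.Bundles using (_⇔_; mk⇔; Equivalence)
import Function.Properties.Equivalence as ⇔
open import Relation.Nullary using (¬_; yes; no)
open import Relation.Binary.PropositionalEquality
  using (_≡_; _≢_; ≢-sym; refl; sym; trans; cong; cong₂; subst; subst₂; setoid; module ≡-Reasoning)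
open import Data.List.Relation.Binary.Permutation.Setoid.Properties (setoid ℕ)
  using () renaming (Unique-resp-↭ to Unique-resp-↭ₛ)
open import Relation.Binary.Definitions using (tri<; tri≈; tri>)
open import Relation.Binary.Construct.Closure.ReflexiveTransitive as Star using (Star; ε; _◅_; _◅◅_)

length-range1 : ∀ n → length (range1 n) ≡ n
length-range1 n = trans (length-map suc (upTo n)) (length-upTo n)

∈-range1⁺ : ∀ {n v} → 0 < v → v ≤ n → v ∈ range1 n
∈-range1⁺ {v = suc u} _ u<n = ∈-map⁺ suc (∈-upTo⁺ u<n)

∈-range1⁻ : ∀ {n v} → v ∈ range1 n → 0 < v × v ≤ n
∈-range1⁻ v∈ with _ , u∈ , refl ← ∈-map⁻ suc v∈ = s≤s z≤n , ∈-upTo⁻ u∈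

range1-increasing : ∀ n → AllPairs _<_ (range1 n)
range1-increasing n = AllPairs.map⁺ (AllPairs.applyUpTo⁺₁ id n (λ i<j _ → s≤s i<j))

Unique-resp-↭ : ∀ {xs ys : List ℕ} → xs ↭ ys → Unique xs → Unique ys
Unique-resp-↭ xs↭ys = Unique-resp-↭ₛ (↭⇒↭ₛ xs↭ys)

IsPerm⇒⊆range1 : ∀ {π} → IsPerm π → All (_∈ range1 (length π)) π
IsPerm⇒⊆range1 π↭ = All-resp-↭ (↭-sym π↭) (All.tabulate id)

IsPerm⇒unique : ∀ {π} → IsPerm π → Unique π
IsPerm⇒unique {π} π↭ = Unique-resp-↭ (↭-sym π↭) (AllPairs.map <⇒≢ (range1-increasing (length π)))

IsPerm⇒∈ : ∀ {π v} → IsPerm π → 0 < v → v ≤ length π → v ∈ π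
IsPerm⇒∈ π↭ 0<v v≤n = ∈-resp-↭ (↭-sym π↭) (∈-range1⁺ 0<v v≤n)

∈-∷⁻ : ∀ {A : Set} {v y : A} {ys} → v ∈ y ∷ ys → v ≢ y → v ∈ ys
∈-∷⁻ (here v≡y) v≢y = ⊥-elim (v≢y v≡y)
∈-∷⁻ (there v∈ys) _ = v∈ys

unique∧⊆∧length⇒↭ : ∀ {A : Set} {xs ys : List A} →
  Unique xs → All (_∈ ys) xs → length ys ≤ length xs → xs ↭ ys
unique∧⊆∧length⇒↭ {xs = []} {[]} _ _ _ = ↭-refl
unique∧⊆∧length⇒↭ {xs = x ∷ xs} (x∉xs ∷ xs!) (x∈ys ∷ xs⊆ys) |ys|≤ with as , bs , refl ← ∈-∃++ x∈ys =
  ↭-trans (prep x (unique∧⊆∧length⇒↭ xs! xs⊆as++bs |as++bs|≤)) (↭-sym (shift x as bs))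
  where
  xs⊆as++bs : All (_∈ as ++ bs) xs
  xs⊆as++bs = All.zipWith (λ (z∈ , x≢z) → ∈-∷⁻ (∈-resp-↭ (shift x as bs) z∈) (≢-sym x≢z)) (xs⊆ys , x∉xs)
  |as++bs|≤ : length (as ++ bs) ≤ length xs
  |as++bs|≤ = ≤-pred (subst (_≤ suc (length xs)) (↭-length (shift x as bs)) |ys|≤)

SameSide : ℕ → ℕ → ℕ → ℕ → Set
SameSide x y a b = ((x < a) ⇔ (y < b)) × ((a < x) ⇔ (b < y))

sameSide-sym : ∀ {x y a b} → SameSide x y a b → SameSide y x b a
sameSide-sym (above , below) = ⇔.sym above , ⇔.sym below

sameSide-trans : ∀ {x y z a b c} → SameSide x y a b → SameSide y z b c → SameSide x z a c
sameSide-trans (above₁ , below₁) (above₂ , below₂) = ⇔.trans above₁ above₂ , ⇔.trans below₁ below₂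

sameSide-below : ∀ {x y a b} → a < x → b < y → SameSide x y a b
sameSide-below a<x b<y = mk⇔ (λ x<a → ⊥-elim (<-asym a<x x<a)) (λ y<b → ⊥-elim (<-asym b<y y<b))
                       , mk⇔ (λ _ → b<y) (λ _ → a<x)

sameSide-≢ : ∀ {x y a b} → SameSide x y a b → x ≢ a → y ≢ b
sameSide-≢ {x} {a = a} (above , below) x≢a y≡b with <-cmp x a
... | tri< x<a _ _ = <-irrefl y≡b (Equivalence.to above x<a)
... | tri≈ _ x≡a _ = x≢a x≡a
... | tri> _ _ a<x = <-irrefl (sym y≡b) (Equivalence.to below a<x)

data _≅_ : List ℕ → List ℕ → Set where
  [] : [] ≅ []
  cons : ∀ {x y xs ys} → Pointwise (SameSide x y) xs ys → xs ≅ ys → (x ∷ xs) ≅ (y ∷ ys)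

≅-length : ∀ {xs ys} → xs ≅ ys → length xs ≡ length ys
≅-length [] = refl
≅-length (cons _ xs≅ys) = cong suc (≅-length xs≅ys)

≅-sym : ∀ {xs ys} → xs ≅ ys → ys ≅ xs
≅-sym [] = []
≅-sym (cons heads tails) = cons (Pointwise.symmetric sameSide-sym heads) (≅-sym tails)

≅-trans : ∀ {xs ys zs} → xs ≅ ys → ys ≅ zs → xs ≅ zs
≅-trans [] [] = []
≅-trans (cons heads₁ tails₁) (cons heads₂ tails₂) =
  cons (Pointwise.transitive sameSide-trans heads₁ heads₂) (≅-trans tails₁ tails₂)

≅⇒OrdIso : ∀ {xs ys} → xs ≅ ys → OrdIso xs ys
≅⇒OrdIso xs≅ys = ≅-length xs≅ys , compare xs≅ys (≅-length xs≅ys)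
  where
  irreflexive⇔ : ∀ a b → (a < a) ⇔ (b < b)
  irreflexive⇔ a b = mk⇔ (⊥-elim ∘ <-irrefl refl) (⊥-elim ∘ <-irrefl refl)
  compare : ∀ {xs ys} → xs ≅ ys → .(e : length xs ≡ length ys) → ∀ i j →
            (lookup xs i < lookup xs j) ⇔ (lookup ys (cast e i) < lookup ys (cast e j))
  compare (cons {x} {y} _ _) _ fzero fzero = irreflexive⇔ x y
  compare (cons heads _) _ fzero (fsuc j) = proj₁ (Pointwise.lookup⁺ heads j)
  compare (cons heads _) _ (fsuc i) fzero = proj₂ (Pointwise.lookup⁺ heads i)
  compare (cons _ tails) e (fsuc i) (fsuc j) = compare tails (suc-injective e) i j

OrdIso⇒≅ : ∀ xs ys → OrdIso xs ys → xs ≅ ys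
OrdIso⇒≅ [] [] _ = []
OrdIso⇒≅ (x ∷ xs) (y ∷ ys) (e , compare) =
  cons (Pointwise.lookup⁻ {R = SameSide x y} (suc-injective e) heads)
       (OrdIso⇒≅ xs ys (suc-injective e , λ i j → compare (fsuc i) (fsuc j)))
  where
  heads : ∀ {i j} → toℕ i ≡ toℕ j → SameSide x y (lookup xs i) (lookup ys j)
  heads {i} {j} i≡j rewrite toℕ-injective (trans (sym i≡j) (sym (toℕ-cast (suc-injective e) i)))
    = compare fzero (fsuc i) , compare (fsuc i) fzero

All-transport : ∀ {R : ℕ → ℕ → Set} {P Q : ℕ → Set} {xs ys} →
  (∀ {a b} → R a b → P b → Q a) → Pointwise R xs ys → All P ys → All Q xs
All-transport f [] [] = []
All-transport f (r ∷ rs) (p ∷ ps) = f r p ∷ All-transport f rs ps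

≅-unique : ∀ {xs ys} → xs ≅ ys → Unique xs → Unique ys
≅-unique [] [] = []
≅-unique (cons heads tails) (x∉ ∷ xs!) =
  All-transport (sameSide-≢ ∘ sameSide-sym) (Pointwise.symmetric sameSide-sym heads) x∉ ∷ ≅-unique tails xs!

≅-map : ∀ (f : ℕ → ℕ) xs → (∀ {a b} → a ∈ xs → b ∈ xs → (a < b) ⇔ (f a < f b)) → xs ≅ map f xs
≅-map f [] _ = []
≅-map f (x ∷ xs) monotone =
  cons (heads (All.tabulate id)) (≅-map f xs (λ a∈ b∈ → monotone (there a∈) (there b∈)))
  where
  heads : ∀ {zs} → All (_∈ xs) zs → Pointwise (SameSide x (f x)) zs (map f zs)
  heads [] = []
  heads (z∈ ∷ zs∈) = (monotone (here refl) (there z∈) , monotone (there z∈) (here refl)) ∷ heads zs∈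

Pointwise-zip : ∀ {R S : ℕ → ℕ → Set} {xs ys} → Pointwise R xs ys → Pointwise S xs ys →
  Pointwise (λ a b → R a b × S a b) xs ys
Pointwise-zip [] [] = []
Pointwise-zip (r ∷ rs) (s ∷ ss) = (r , s) ∷ Pointwise-zip rs ss

-- R rides along so that the induction remembers how each kept head compares with the entries kept after it.
≅-⊆ : ∀ {R : ℕ → ℕ → Set} {c τ s} → Pointwise R c τ → c ≅ τ → s ⊆ τ →
  ∃ λ s′ → s′ ⊆ c × Pointwise R s′ s × s′ ≅ s
≅-⊆ [] [] [] = [] , [] , [] , []
≅-⊆ (_ ∷ rs) (cons _ tails) (_ ∷ʳ s⊆τ) with s′ , s′⊆c , rs′ , s′≅s ← ≅-⊆ rs tails s⊆τ =
  s′ , _ ∷ʳ s′⊆c , rs′ , s′≅s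
≅-⊆ (r ∷ rs) (cons heads tails) (refl ∷ s⊆τ)
  with s′ , s′⊆c , rhs′ , s′≅s ← ≅-⊆ (Pointwise-zip rs heads) tails s⊆τ =
  _ , refl ∷ s′⊆c , r ∷ Pointwise.map proj₁ rhs′ , cons (Pointwise.map proj₂ rhs′) s′≅s

_≼_ : List ℕ → List ℕ → Set
β ≼ π = ∃ λ s → s ⊆ π × s ≅ β

≼⇒Contains : ∀ {π β} → β ≼ π → Contains π β
≼⇒Contains (s , s⊆π , s≅β) = s , s⊆π , ≅⇒OrdIso s≅β

Contains⇒≼ : ∀ {π β} → Contains π β → β ≼ π
Contains⇒≼ (s , s⊆π , s≅β) = s , s⊆π , OrdIso⇒≅ _ _ s≅β

≼-⊆ : ∀ {β π π′} → π ⊆ π′ → β ≼ π → β ≼ π′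
≼-⊆ π⊆π′ (s , s⊆π , s≅β) = s , ⊆-trans s⊆π π⊆π′ , s≅β

≼-resp-≅ : ∀ {β c τ} → c ≅ τ → β ≼ τ → β ≼ c
≼-resp-≅ c≅τ (s , s⊆τ , s≅β) =
  let s′ , s′⊆c , _ , s′≅s = ≅-⊆ (trivial c≅τ) c≅τ s⊆τ in s′ , s′⊆c , ≅-trans s′≅s s≅β
  where
  trivial : ∀ {xs ys} → xs ≅ ys → Pointwise (λ _ _ → ⊤) xs ys
  trivial [] = []
  trivial (cons _ tails) = tt ∷ trivial tails

≼[]⇒≡[] : ∀ {β} → β ≼ [] → β ≡ []
≼[]⇒≡[] (_ , [] , []) = refl

countBelow : ℕ → List ℕ → ℕ
countBelow v [] = 0
countBelow v (x ∷ xs) with x <? v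
... | yes _ = suc (countBelow v xs)
... | no _ = countBelow v xs

countBelow-mono : ∀ {a b} xs → a ≤ b → countBelow a xs ≤ countBelow b xs
countBelow-mono [] _ = z≤n
countBelow-mono {a} {b} (x ∷ xs) a≤b with x <? a | x <? b
... | yes _ | yes _ = s≤s (countBelow-mono xs a≤b)
... | yes x<a | no x≮b = ⊥-elim (x≮b (<-≤-trans x<a a≤b))
... | no _ | yes _ = m≤n⇒m≤1+n (countBelow-mono xs a≤b)
... | no _ | no _ = countBelow-mono xs a≤b

countBelow-strict : ∀ {a b xs} → a < b → a ∈ xs → countBelow a xs < countBelow b xs
countBelow-strict {a} {b} {x ∷ xs} a<b a∈ with x <? a | x <? b | a∈
... | yes x<a | _ | here refl = ⊥-elim (<-irrefl refl x<a)
... | yes x<a | no x≮b | _ = ⊥-elim (x≮b (<-trans x<a a<b))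
... | yes _ | yes _ | there a∈xs = s≤s (countBelow-strict a<b a∈xs)
... | no _ | yes _ | here refl = s≤s (countBelow-mono xs (<⇒≤ a<b))
... | no _ | yes _ | there a∈xs = m<n⇒m<1+n (countBelow-strict a<b a∈xs)
... | no _ | no x≮b | here refl = ⊥-elim (x≮b a<b)
... | no _ | no _ | there a∈xs = countBelow-strict a<b a∈xs

countBelow-≤ : ∀ v xs → countBelow v xs ≤ length xs
countBelow-≤ v [] = z≤n
countBelow-≤ v (x ∷ xs) with x <? v
... | yes _ = s≤s (countBelow-≤ v xs)
... | no _ = m≤n⇒m≤1+n (countBelow-≤ v xs)

countBelow-< : ∀ {v xs} → v ∈ xs → countBelow v xs < length xs
countBelow-< {v} {x ∷ xs} v∈ with x <? v | v∈
... | yes x<v | here refl = ⊥-elim (<-irrefl refl x<v)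
... | yes _ | there v∈xs = s≤s (countBelow-< v∈xs)
... | no _ | here refl = s≤s (countBelow-≤ v xs)
... | no _ | there v∈xs = m<n⇒m<1+n (countBelow-< v∈xs)

rank : List ℕ → ℕ → ℕ
rank c v = suc (countBelow v c)

rank-<-⇔ : ∀ {c a b} → a ∈ c → (a < b) ⇔ (rank c a < rank c b)
rank-<-⇔ {c} {a} {b} a∈c = mk⇔ (λ a<b → s≤s (countBelow-strict a<b a∈c)) reflect
  where
  reflect : rank c a < rank c b → a < b
  reflect ra<rb with a <? b
  ... | yes a<b = a<b
  ... | no a≮b = ⊥-elim (<-irrefl refl (<-≤-trans (≤-pred ra<rb) (countBelow-mono c (≮⇒≥ a≮b))))

standardise : List ℕ → List ℕ
standardise c = map (rank c) c

≅-standardise : ∀ c → c ≅ standardise c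
≅-standardise c = ≅-map (rank c) c (λ a∈c _ → rank-<-⇔ a∈c)

standardise-IsPerm : ∀ {c} → Unique c → IsPerm (standardise c)
standardise-IsPerm {c} c! = unique∧⊆∧length⇒↭ (≅-unique (≅-standardise c) c!) in-range1 (≤-reflexive (length-range1 _))
  where
  in-range1 : All (_∈ range1 (length (standardise c))) (standardise c)
  in-range1 = All.map⁺ (All.tabulate (λ v∈c →
    ∈-range1⁺ (s≤s z≤n) (subst (rank c _ ≤_) (sym (length-map (rank c) c)) (countBelow-< v∈c))))

Avoids : (List ℕ → Set) → List ℕ → Set
Avoids B w = ∀ β → B β → ¬ β ≼ w

InClass⇒Avoids : ∀ {B c} → InClass (Av B) c → Avoids B c
InClass⇒Avoids (τ , (_ , τ-avoids) , c≅τ) β β∈B β≼c =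
  τ-avoids β β∈B (≼⇒Contains (≼-resp-≅ (≅-sym (OrdIso⇒≅ _ _ c≅τ)) β≼c))

unique∧Avoids⇒InClass : ∀ {B c} → Unique c → Avoids B c → InClass (Av B) c
unique∧Avoids⇒InClass {c = c} c! c-avoids =
  standardise c
  , (standardise-IsPerm c! , λ β β∈B β≤std → c-avoids β β∈B (≼-resp-≅ (≅-standardise c) (Contains⇒≼ β≤std)))
  , ≅⇒OrdIso (≅-standardise c)

IsPerm⇒<top : ∀ {β} → IsPerm β → All (_< suc (length β)) β
IsPerm⇒<top β↭ = All.map (λ v∈ → s≤s (proj₂ (∈-range1⁻ v∈))) (IsPerm⇒⊆range1 β↭)

≅-Pointwise-below : ∀ {x y xs ys} → xs ≅ ys → All (_< x) xs → All (_< y) ys →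
  Pointwise (SameSide x y) xs ys
≅-Pointwise-below [] [] [] = []
≅-Pointwise-below (cons _ tails) (a<x ∷ as<x) (b<y ∷ bs<y) =
  sameSide-below a<x b<y ∷ ≅-Pointwise-below tails as<x bs<y

skew1-≼⁻ : ∀ {β h s} → All (_< suc (length β)) β → (h ∷ s) ≅ skew1 β → All (_< h) s
skew1-≼⁻ β<top (cons heads _) = All-transport (λ (_ , below) → Equivalence.from below) heads β<top

skew1-≼⁺ : ∀ {β y c} → All (_< suc (length β)) β → β ≼ c → All (_< y) c → skew1 β ≼ (y ∷ c)
skew1-≼⁺ β<top (s , s⊆c , s≅β) c<y =
  _ ∷ s , refl ∷ s⊆c , cons (≅-Pointwise-below s≅β (All-resp-⊆ s⊆c c<y) β<top) s≅β

⊆-++-∷⁻ : ∀ {s} w₁ x w₂ → s ⊆ w₁ ++ x ∷ w₂ →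
  s ⊆ w₁ ++ w₂ ⊎ ∃ λ (s₁ : List ℕ) → ∃ λ s₂ → s ≡ s₁ ++ x ∷ s₂ × s₁ ⊆ w₁ × s₂ ⊆ w₂
⊆-++-∷⁻ [] x w₂ (.x ∷ʳ s⊆w₂) = inj₁ s⊆w₂
⊆-++-∷⁻ [] x w₂ (refl ∷ s⊆w₂) = inj₂ ([] , _ , refl , [] , s⊆w₂)
⊆-++-∷⁻ (a ∷ w₁) x w₂ (.a ∷ʳ s⊆) with ⊆-++-∷⁻ w₁ x w₂ s⊆
... | inj₁ s⊆w₁w₂ = inj₁ (a ∷ʳ s⊆w₁w₂)
... | inj₂ (s₁ , s₂ , refl , s₁⊆w₁ , s₂⊆w₂) = inj₂ (s₁ , s₂ , refl , a ∷ʳ s₁⊆w₁ , s₂⊆w₂)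
⊆-++-∷⁻ (a ∷ w₁) x w₂ (refl ∷ s⊆) with ⊆-++-∷⁻ w₁ x w₂ s⊆
... | inj₁ s⊆w₁w₂ = inj₁ (refl ∷ s⊆w₁w₂)
... | inj₂ (s₁ , s₂ , refl , s₁⊆w₁ , s₂⊆w₂) = inj₂ (a ∷ s₁ , s₂ , refl , refl ∷ s₁⊆w₁ , s₂⊆w₂)

-- An occurrence of 1 ⊖ β using the new maximum x must start at x, since its first entry is its largest.
insert-max-avoids-skew1 : ∀ {β x} w₁ w₂ → All (_< suc (length β)) β → All (_< x) w₁ →
  ¬ skew1 β ≼ (w₁ ++ w₂) → ¬ β ≼ w₂ → ¬ skew1 β ≼ (w₁ ++ x ∷ w₂)
insert-max-avoids-skew1 w₁ w₂ β<top w₁<x w-avoids w₂-avoids (s , s⊆ , s≅) with ⊆-++-∷⁻ w₁ _ w₂ s⊆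
... | inj₁ s⊆w₁w₂ = w-avoids (s , s⊆w₁w₂ , s≅)
... | inj₂ ([] , s₂ , refl , _ , s₂⊆w₂) with cons _ s₂≅β ← s≅ = w₂-avoids (s₂ , s₂⊆w₂ , s₂≅β)
... | inj₂ (h ∷ s₁ , s₂ , refl , h∷s₁⊆w₁ , _) = <-asym h<x x<h
  where
  h<x = All.head (All-resp-⊆ h∷s₁⊆w₁ w₁<x)
  x<h = All.head (All.++⁻ʳ s₁ (skew1-≼⁻ β<top s≅))

contents : State → List ℕ
contents (inp , c , out) = out ++ c ++ inp

Step-↭ : ∀ {C s t} → Step C s t → contents s ↭ contents t
Step-↭ {s = x ∷ inp , c , out} bypass = begin
  out ++ c ++ x ∷ inp          ↭⟨ Perm.++⁺ˡ out (shift x c inp) ⟩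
  out ++ x ∷ c ++ inp          ≡⟨ ++-assoc out [ x ] (c ++ inp) ⟨
  (out ++ [ x ]) ++ c ++ inp   ∎
  where open PermutationReasoning
Step-↭ {s = x ∷ inp , _ , out} (push l r _) = begin
  out ++ (l ++ r) ++ x ∷ inp   ≡⟨ cong (out ++_) (++-assoc l r (x ∷ inp)) ⟩
  out ++ l ++ r ++ x ∷ inp     ↭⟨ Perm.++⁺ˡ out (Perm.++⁺ˡ l (shift x r inp)) ⟩
  out ++ l ++ x ∷ r ++ inp     ≡⟨ cong (out ++_) (++-assoc l (x ∷ r) inp) ⟨
  out ++ (l ++ x ∷ r) ++ inp   ∎
  where open PermutationReasoning
Step-↭ {s = inp , x ∷ c , out} pop = ↭-reflexive (sym (++-assoc out [ x ] (c ++ inp)))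

Star-↭ : ∀ {C s t} → Star (Step C) s t → contents s ↭ contents t
Star-↭ = Star.fold (λ s t → contents s ↭ contents t) (↭-trans ∘ Step-↭) ↭-refl

module Generation⇒Avoidance (B : List ℕ → Set) (B-perms : ∀ β → B β → IsPerm β) where

  -- w is the word formed by the output followed by the container.
  record Good (inp c w : List ℕ) : Set where
    field
      increasing : AllPairs _<_ inp
      below-input : All (λ a → All (a <_) inp) w
      container-avoids : Avoids B c
      word-avoids : ∀ β → B β → ¬ skew1 β ≼ w

  insert-next : ∀ {x inp c c′} w₁ w₂ → Good (x ∷ inp) c (w₁ ++ w₂) → Avoids B c′ → w₂ ⊆ c′ →
    Good inp c′ (w₁ ++ x ∷ w₂)
  insert-next w₁ w₂ G c′-avoids w₂⊆c′ with x<inp ∷ inp-increasing ← Good.increasing G = record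
    { increasing = inp-increasing
    ; below-input = All.++⁺ (All.++⁻ˡ w₁ tails) (x<inp ∷ All.++⁻ʳ w₁ tails)
    ; container-avoids = c′-avoids
    ; word-avoids = λ β β∈B → insert-max-avoids-skew1 w₁ w₂ (IsPerm⇒<top (B-perms β β∈B))
        (All.++⁻ˡ w₁ (All.map All.head below-input)) (word-avoids β β∈B) (c′-avoids β β∈B ∘ ≼-⊆ w₂⊆c′)
    }
    where
    open Good G
    tails = All.map All.tail below-input

  pop-next : ∀ {x inp c w} → Good inp (x ∷ c) w → Good inp c w
  pop-next G = record
    { increasing = increasing
    ; below-input = below-input
    ; container-avoids = λ β β∈B → container-avoids β β∈B ∘ ≼-⊆ (_ ∷ʳ ⊆-refl)
    ; word-avoids = word-avoids
    }
    where open Good G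

  GoodState : State → Set
  GoodState (inp , c , out) = Good inp c (out ++ c)

  Step-good : ∀ {s t} → Step (Av B) s t → GoodState s → GoodState t
  Step-good {x ∷ inp , c , out} bypass G =
    subst (Good inp c) (sym (++-assoc out [ x ] c)) (insert-next out c G (Good.container-avoids G) ⊆-refl)
  Step-good {x ∷ inp , _ , out} (push l r in-class) G =
    subst (Good inp _) (++-assoc out l (x ∷ r))
      (insert-next (out ++ l) r (subst (Good _ _) (sym (++-assoc out l r)) G)
        (InClass⇒Avoids in-class) (++⁺ˡ l (x ∷ʳ ⊆-refl)))
  Step-good {inp , x ∷ c , out} pop G = subst (Good inp c) (sym (++-assoc out [ x ] c)) (pop-next G)

  Star-good : ∀ {s t} → Star (Step (Av B)) s t → GoodState s → GoodState t
  Star-good = Star.fold (λ s t → GoodState s → GoodState t) (λ step next → next ∘ Step-good step) (λ G → G)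

generated⇒avoids : ∀ B → (∀ β → B β → IsPerm β) → (∀ β → B β → β ≢ []) →
  ∀ π → Generated (Av B) π → Av (SkewSet B) π
generated⇒avoids B B-perms B-nonempty π run = π-perm , π-avoids
  where
  open Generation⇒Avoidance B B-perms
  π-perm : IsPerm π
  π-perm = subst (_↭ range1 (length π)) (++-identityʳ π) (↭-sym (Star-↭ run))
  initial : Good (range1 (length π)) [] []
  initial = record
    { increasing = range1-increasing (length π)
    ; below-input = []
    ; container-avoids = λ β β∈B → B-nonempty β β∈B ∘ ≼[]⇒≡[]   -- [] ∈ B would forbid even the empty container
    ; word-avoids = λ β _ occurrence → case ≼[]⇒≡[] occurrence of λ ()
    }
  π-avoids : ∀ σ → SkewSet B σ → ¬ Contains π σ
  π-avoids _ (β , β∈B , refl) occurrence = Good.word-avoids (Star-good run initial) β β∈B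
    (subst (skew1 β ≼_) (sym (++-identityʳ π)) (Contains⇒≼ occurrence))

interval : ℕ → ℕ → List ℕ
interval k zero = []
interval k (suc d) = suc k ∷ interval (suc k) d

applyUpTo-interval : ∀ {f : ℕ → ℕ} k d → (∀ i → f i ≡ suc (k + i)) → applyUpTo f d ≡ interval k d
applyUpTo-interval k zero f≗ = refl
applyUpTo-interval k (suc d) f≗ = cong₂ _∷_
  (trans (f≗ 0) (cong suc (+-identityʳ k)))
  (applyUpTo-interval (suc k) d (λ i → trans (f≗ (suc i)) (cong suc (+-suc k i))))

range1≡interval : ∀ n → range1 n ≡ interval 0 n
range1≡interval n = trans (map-upTo suc n) (applyUpTo-interval 0 n (λ _ → refl))

atMost : ℕ → List ℕ → List ℕ
atMost k = filter (_≤? k)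

atMost-suc : ∀ {k} xs → suc k ∉ xs → atMost (suc k) xs ≡ atMost k xs
atMost-suc [] _ = refl
atMost-suc {k} (x ∷ xs) k+1∉ with x ≤? k
... | yes x≤k = begin
  atMost (suc k) (x ∷ xs)  ≡⟨ filter-accept (_≤? suc k) (m≤n⇒m≤1+n x≤k) ⟩
  x ∷ atMost (suc k) xs    ≡⟨ cong (x ∷_) (atMost-suc xs (k+1∉ ∘ there)) ⟩
  x ∷ atMost k xs          ≡⟨ filter-accept (_≤? k) x≤k ⟨
  atMost k (x ∷ xs)        ∎
  where open ≡-Reasoning
... | no x≰k = begin
  atMost (suc k) (x ∷ xs)  ≡⟨ filter-reject (_≤? suc k) x≰k+1 ⟩
  atMost (suc k) xs        ≡⟨ atMost-suc xs (k+1∉ ∘ there) ⟩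
  atMost k xs              ≡⟨ filter-reject (_≤? k) x≰k ⟨
  atMost k (x ∷ xs)        ∎
  where
  open ≡-Reasoning
  x≰k+1 : ¬ x ≤ suc k
  x≰k+1 x≤k+1 = k+1∉ (here (≤-antisym (≰⇒> x≰k) x≤k+1))

atMost-split : ∀ {k} xs → Unique xs → suc k ∈ xs →
  ∃ λ l → ∃ λ r → atMost (suc k) xs ≡ l ++ suc k ∷ r × atMost k xs ≡ l ++ r
atMost-split {k} xs xs! k+1∈ with as , bs , refl ← ∈-∃++ k+1∈ =
  atMost k as , atMost k bs , split-suc , split
  where
  open ≡-Reasoning
  k+1∉ : suc k ∉ as ++ bs
  k+1∉ = Unique.Unique[x∷xs]⇒x∉xs (Unique-resp-↭ (shift (suc k) as bs) xs!)
  split-suc : atMost (suc k) (as ++ suc k ∷ bs) ≡ atMost k as ++ suc k ∷ atMost k bs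
  split-suc = begin
    atMost (suc k) (as ++ suc k ∷ bs)                  ≡⟨ filter-++ (_≤? suc k) as (suc k ∷ bs) ⟩
    atMost (suc k) as ++ atMost (suc k) (suc k ∷ bs)   ≡⟨ cong (atMost (suc k) as ++_)
                                                           (filter-accept (_≤? suc k) ≤-refl) ⟩
    atMost (suc k) as ++ suc k ∷ atMost (suc k) bs     ≡⟨ cong₂ (λ l r → l ++ suc k ∷ r)
                                                           (atMost-suc as (k+1∉ ∘ ∈-++⁺ˡ)) (atMost-suc bs (k+1∉ ∘ ∈-++⁺ʳ as)) ⟩
    atMost k as ++ suc k ∷ atMost k bs                 ∎
  split : atMost k (as ++ suc k ∷ bs) ≡ atMost k as ++ atMost k bs
  split = begin
    atMost k (as ++ suc k ∷ bs)           ≡⟨ filter-++ (_≤? k) as (suc k ∷ bs) ⟩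
    atMost k as ++ atMost k (suc k ∷ bs)  ≡⟨ cong (atMost k as ++_) (filter-reject (_≤? k) (<-irrefl refl)) ⟩
    atMost k as ++ atMost k bs            ∎

-- With 1, …, k read, the container holds the entries ≤ k not yet output, in π-order.
module Avoidance⇒Generation (B : List ℕ → Set) (B-perms : ∀ β → B β → IsPerm β) (π : List ℕ)
                            (π-avoids : ∀ β → B β → ¬ skew1 β ≼ π) where

  n : ℕ
  n = length π

  input : ℕ → List ℕ
  input k = interval k (n ∸ k)

  input-suc : ∀ {k} → k < n → input k ≡ suc k ∷ input (suc k)
  input-suc k<n = cong (interval _) (+-∸-assoc 1 k<n)

  input-end : ∀ {k} → n ≤ k → input k ≡ []
  input-end n≤k = cong (interval _) (m≤n⇒m∸n≡0 n≤k)

  Run : State → State → Set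
  Run = Star (Step (Av B))

  bypass-next : ∀ {k c out} → k < n →
    Step (Av B) (input k , c , out) (input (suc k) , c , out ++ [ suc k ])
  bypass-next k<n rewrite input-suc k<n = bypass

  push-next : ∀ {k out} l r → k < n → InClass (Av B) (l ++ suc k ∷ r) →
    Step (Av B) (input k , l ++ r , out) (input (suc k) , l ++ suc k ∷ r , out)
  push-next l r k<n in-class rewrite input-suc k<n = push l r in-class

  -- The container entries all follow y in π and lie below it, so with y in front they would form 1 ⊖ β.
  container-in-class : ∀ {out y rest v} → out ++ y ∷ rest ≡ π → Unique rest → v < y →
    InClass (Av B) (atMost v rest)
  container-in-class {out} {y} {rest} {v} π≡ rest! v<y =
    unique∧Avoids⇒InClass (Unique.filter⁺ (_≤? v) rest!) avoids
    where
    y∷c⊆π : y ∷ atMost v rest ⊆ π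
    y∷c⊆π = subst (y ∷ atMost v rest ⊆_) π≡ (++⁺ˡ out (refl ∷ filter-⊆ (_≤? v) rest))
    c<y : All (_< y) (atMost v rest)
    c<y = All.map (λ a≤v → ≤-<-trans a≤v v<y) (All.all-filter (_≤? v) rest)
    avoids : Avoids B (atMost v rest)
    avoids β β∈B β≼c = π-avoids β β∈B (≼-⊆ y∷c⊆π (skew1-≼⁺ (IsPerm⇒<top (B-perms β β∈B)) β≼c c<y))

  push-until : ∀ {out y rest k} → out ++ y ∷ rest ≡ π → Unique (y ∷ rest) → y ≤ n →
    (∀ {v} → k < v → v < y → v ∈ rest) → k <‴ y →
    Run (input k , atMost k rest , out) (input y , atMost y rest , out ++ [ y ])
  push-until {rest = rest} π≡ y∷rest! y≤n _ ≤‴-refl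
    rewrite atMost-suc rest (Unique.Unique[x∷xs]⇒x∉xs y∷rest!) = bypass-next y≤n ◅ ε
  push-until {out} {y} {rest} {k} π≡ y∷rest!@(_ ∷ rest!) y≤n covers (≤‴-step k+1<‴y)
    with l , r , split-suc , split ← atMost-split rest rest! (covers (n<1+n k) (≤‴⇒≤ k+1<‴y))
    rewrite split =
      push-next l r k<n (subst (InClass (Av B)) split-suc (container-in-class π≡ rest! k+1<y))
      ◅ subst (λ c → Run (input (suc k) , c , out) _) split-suc (push-until π≡ y∷rest! y≤n (covers ∘ <⇒≤) k+1<‴y)
    where
    k+1<y : suc k < y
    k+1<y = ≤‴⇒≤ k+1<‴y
    k<n : k < n
    k<n = <-≤-trans (n<1+n k) (<⇒≤ (<-≤-trans k+1<y y≤n))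

  emit : ∀ {out rest} k → out ++ rest ≡ π → Unique rest → All (_≤ n) rest →
    (∀ {v} → k < v → v ≤ n → v ∈ rest) → Run (input k , atMost k rest , out) ([] , [] , π)
  emit {out} {[]} k π≡ _ _ covers rewrite input-end (≮⇒≥ (λ k<n → case covers (n<1+n k) k<n of λ ())) =
    subst (λ o → Run ([] , [] , out) ([] , [] , o)) (trans (sym (++-identityʳ out)) π≡) ε
  emit {out} {y ∷ rest} k π≡ y∷rest!@(_ ∷ rest!) (y≤n ∷ rest≤n) covers with y ≤? k
  ... | yes y≤k rewrite filter-accept (_≤? k) {y} {rest} y≤k =
    pop ◅ emit k π≡′ rest! rest≤n (λ k<v v≤n → ∈-∷⁻ (covers k<v v≤n) (>⇒≢ (≤-<-trans y≤k k<v)))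
    where π≡′ = trans (++-assoc out [ y ] rest) π≡
  ... | no y≰k rewrite filter-reject (_≤? k) {y} {rest} y≰k =
    push-until π≡ y∷rest! y≤n (λ k<v v<y → ∈-∷⁻ (covers k<v (<⇒≤ (<-≤-trans v<y y≤n))) (<⇒≢ v<y)) (≤⇒≤‴ k<y)
    ◅◅ emit y π≡′ rest! rest≤n (λ y<v v≤n → ∈-∷⁻ (covers (<-trans k<y y<v) v≤n) (>⇒≢ y<v))
    where
    k<y = ≰⇒> y≰k
    π≡′ = trans (++-assoc out [ y ] rest) π≡

avoids⇒generated : ∀ B → (∀ β → B β → IsPerm β) → ∀ π → Av (SkewSet B) π → Generated (Av B) π
avoids⇒generated B B-perms π (π-perm , π-avoids) =
  subst₂ (λ inp c → Star (Step (Av B)) (inp , c , []) ([] , [] , π))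
    (sym (range1≡interval (length π))) no-small-entries
    (emit 0 refl (IsPerm⇒unique π-perm) (All.map (proj₂ ∘ ∈-range1⁻) π⊆range1) (IsPerm⇒∈ π-perm))
  where
  open Avoidance⇒Generation B B-perms π (λ β β∈B → π-avoids (skew1 β) (β , β∈B , refl) ∘ ≼⇒Contains)
  π⊆range1 = IsPerm⇒⊆range1 π-perm
  no-small-entries : atMost 0 π ≡ []
  no-small-entries = filter-none (_≤? 0) (All.map (λ v∈ → <⇒≱ (proj₁ (∈-range1⁻ v∈))) π⊆range1)

theorem1p1 : (B : List ℕ → Set) →
    (∀ β → B β → IsPerm β) →
    (∀ β → B β → β ≢ []) →
    ∀ (π : List ℕ) → Generated (Av B) π ⇔ Av (SkewSet B) π
theorem1p1 B B-perms B-nonempty π =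
  mk⇔ (generated⇒avoids B B-perms B-nonempty π) (avoids⇒generated B B-perms π)
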